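{- Let $p$ be a prime and let $r, s \in \{0, 1, \dots, p-1\}$ with $s > r$. Then $(r,s) \notin D(p)$; that is, there exist integers $a \geq 0$ and $b \geq 0$ such that $\binom{pa+r}{pb+s} \not\equiv \binom{a}{b}\binom{r}{s} \pmod{p^2}$.
   Context: For a prime $p$, $D(p)$ denotes the set of pairs $(r,s) \in \{0,1,\dots,p-1\}^2$ such that $\binom{pa+r}{pb+s} \equiv \binom{a}{b}\binom{r}{s} \pmod{p^2}$ for all integers $a \geq 0$ and $b \geq 0$. Binomial coefficients $\binom{n}{k}$ with $k > n \geq 0$ are $0$. -}

module Defs where

open import Data.Nat using (ℕ; _+_; _*_; _^_)
open import Data.Nat.Combinatorics using (_C_)
open import Data.Integer as ℤ using (ℤ; +_)
open import Data.Integer.Divisibility using () renaming (_∣_ to _∣ℤ_)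

_≡_[mod_] : ℕ → ℕ → ℕ → Set
x ≡ y [mod m ] = (+ m) ∣ℤ ((+ x) ℤ.- (+ y))

-- (r , s) ∈ D(p) : for all a, b ≥ 0,
-- C(pa+r, pb+s) ≡ C(a,b) C(r,s) (mod p^2)
-- (stdlib's n C k is 0 when k > n)
InD : ℕ → ℕ → ℕ → Set
InD p r s = ∀ (a b : ℕ) →
  ((p * a + r) C (p * b + s)) ≡ ((a C b) * (r C s)) [mod (p ^ 2) ]

module Submission where

-- Take a = 1 and b = 0.  Since s > r we have C(r,s) = 0,
-- so the congruence at (1, 0) would say p² ∣ C(p + r, s).  But a binomial
-- coefficient C(n,k) with k ≤ n divides n!, and (p + r)! is divisible by p
-- exactly once when r < p: the factor p occurs among 1, …, p + r, and every
-- other factor is a positive number below 2p different from p, hence prime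
-- to p.  So p² ∤ (p + r)!, hence p² ∤ C(p + r, s), and (r , s) ∉ D(p).

open import Defs
open import Data.Nat using (ℕ; _+_; _*_; _^_; _<_; _>_)
open import Data.Nat.Combinatorics using (_C_)
open import Data.Nat.Primality using (Prime)
open import Data.Product using (_×_; ∃-syntax)
open import Relation.Nullary using (¬_)

open import Data.Nat using (zero; suc; _!; _≤_; _∸_; NonZero)
open import Data.Nat.Properties
  using (+-suc; +-identityʳ; *-identityʳ; *-zeroʳ; *-commutativeSemigroup; m≤m+n; n<1+n;
         <-trans; <⇒≤; ≤-trans; _!*_!≢0)
open import Data.Nat.Divisibility
  using (_∣_; _∤_; ∣-refl; ∣-trans; ∣1⇒≡1; ∣m+n∣m⇒∣n; *-cancelˡ-∣; m/n∣m; >⇒∤)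
open import Data.Nat.Combinatorics using (nCk≡n!/k![n-k]!; k![n∸k]!∣n!; k>n⇒nCk≡0)
open import Data.Nat.Primality using (euclidsLemma; prime⇒nonZero; prime⇒nonTrivial)
open import Data.Nat.Base using (nonTrivial⇒≢1)
open import Data.Product using (_,_)
open import Data.Sum using (inj₁; inj₂)
open import Algebra.Properties.CommutativeSemigroup *-commutativeSemigroup
  using (x∙yz≈y∙xz)
open import Relation.Binary.PropositionalEquality
  using (_≡_; refl; sym; trans; cong; cong₂; subst; module ≡-Reasoning)

binomial∣factorial : ∀ {n k} → k ≤ n → n C k ∣ n !
binomial∣factorial {n} {k} k≤n =
  subst (_∣ n !) (sym (nCk≡n!/k![n-k]! k≤n)) (m/n∣m (k![n∸k]!∣n! k≤n))
  where instance _ = k !* (n ∸ k) !≢0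

factorial-unfold : ∀ n .{{_ : NonZero n}} → n ! ≡ n * (n ∸ 1) !
factorial-unfold (suc n) = refl

pred<self : ∀ n .{{_ : NonZero n}} → n ∸ 1 < n
pred<self (suc n) = n<1+n n

module _ {p : ℕ} (p-prime : Prime p) where

  instance
    p≢0 : NonZero p
    p≢0 = prime⇒nonZero p-prime

  prime∤* : ∀ {m n} → p ∤ m → p ∤ n → p ∤ m * n
  prime∤* {m} {n} p∤m p∤n p∣mn with euclidsLemma m n p-prime p∣mn
  ... | inj₁ p∣m = p∤m p∣m
  ... | inj₂ p∣n = p∤n p∣n

  -- All factors of n! are positive and below p, so none is divisible by p.
  prime∤factorial : ∀ {n} → n < p → p ∤ n !
  prime∤factorial {zero}  _    p∣1 = nonTrivial⇒≢1 {{prime⇒nonTrivial p-prime}} (∣1⇒≡1 p∣1)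
  prime∤factorial {suc n} n<p =
    prime∤* (>⇒∤ n<p) (prime∤factorial (<-trans (n<1+n n) n<p))

  -- p occurs exactly once in (p + r)! for r < p: p! = p · (p - 1)!, and the
  -- further factors p + 1, …, p + r are congruent to 1, …, r modulo p.
  factorial-exactly-one-p : ∀ {r} → r < p → ∃[ Z ] (p + r) ! ≡ p * Z × p ∤ Z
  factorial-exactly-one-p {zero} _ =
    (p ∸ 1) ! ,
    trans (cong _! (+-identityʳ p)) (factorial-unfold p) ,
    prime∤factorial (pred<self p)
  factorial-exactly-one-p {suc r} 1+r<p
    with factorial-exactly-one-p (<-trans (n<1+n r) 1+r<p)
  ... | Z , [p+r]!≡pZ , p∤Z = suc (p + r) * Z , unfold , prime∤* p∤p+1+r p∤Z
    where
    unfold : (p + suc r) ! ≡ p * (suc (p + r) * Z)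
    unfold = begin
      (p + suc r) !           ≡⟨ cong _! (+-suc p r) ⟩
      suc (p + r) * (p + r) ! ≡⟨ cong (suc (p + r) *_) [p+r]!≡pZ ⟩
      suc (p + r) * (p * Z)   ≡⟨ x∙yz≈y∙xz (suc (p + r)) p Z ⟩
      p * (suc (p + r) * Z)   ∎
      where open ≡-Reasoning
    p∤p+1+r : p ∤ suc (p + r)
    p∤p+1+r p∣ = >⇒∤ 1+r<p (∣m+n∣m⇒∣n (subst (p ∣_) (sym (+-suc p r)) p∣) ∣-refl)

  p²∤factorial : ∀ {r} → r < p → p ^ 2 ∤ (p + r) !
  p²∤factorial r<p p²∣ with factorial-exactly-one-p r<p
  ... | Z , [p+r]!≡pZ , p∤Z =
    p∤Z (subst (_∣ Z) (*-identityʳ p) (*-cancelˡ-∣ p (subst (p ^ 2 ∣_) [p+r]!≡pZ p²∣)))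

≡0[mod]⇒∣ : ∀ {m x y} → y ≡ 0 → x ≡ y [mod m ] → m ∣ x
≡0[mod]⇒∣ {m} {x} refl m∣x-0 = subst (m ∣_) (+-identityʳ x) m∣x-0

fails-at-1-0 : ∀ {p} → Prime p → ∀ {r s} → r < p → s < p → s > r →
  ¬ (((p * 1 + r) C (p * 0 + s)) ≡ ((1 C 0) * (r C s)) [mod (p ^ 2) ])
fails-at-1-0 {p} p-prime {r} {s} r<p s<p s>r congruent =
  p²∤factorial p-prime r<p (∣-trans p²∣C (binomial∣factorial s≤p+r))
  where
  s≤p+r : s ≤ p + r
  s≤p+r = ≤-trans (<⇒≤ s<p) (m≤m+n p r)
  rhs≡0 : (1 C 0) * (r C s) ≡ 0
  rhs≡0 = cong ((1 C 0) *_) (k>n⇒nCk≡0 s>r)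
  lhs≡ : (p * 1 + r) C (p * 0 + s) ≡ (p + r) C s
  lhs≡ = cong₂ _C_ (cong (_+ r) (*-identityʳ p)) (cong (_+ s) (*-zeroʳ p))
  p²∣C : p ^ 2 ∣ (p + r) C s
  p²∣C = subst (p ^ 2 ∣_) lhs≡ (≡0[mod]⇒∣ rhs≡0 congruent)

proposition1 : (p : ℕ) → Prime p → (r s : ℕ) → r < p → s < p → s > r →
    ¬ InD p r s ×
    ∃[ a ] ∃[ b ] ¬ (((p * a + r) C (p * b + s)) ≡ ((a C b) * (r C s)) [mod (p ^ 2) ])
proposition1 p p-prime r s r<p s<p s>r =
  (λ inD → fails (inD 1 0)) , 1 , 0 , fails
  where
  fails : ¬ (((p * 1 + r) C (p * 0 + s)) ≡ ((1 C 0) * (r C s)) [mod (p ^ 2) ])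
  fails = fails-at-1-0 p-prime r<p s<p s>r
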